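{- Let $k$ be a field and $w,w'\in F_k$. (i) If $w,w'\in\mathcal A$, then $ww'\in\mathcal C$ and $w\alpha w'\in\mathcal A$ for every $\alpha\in k$. (ii) If exactly one of $w,w'$ belongs to $\mathcal A$, then $w\alpha w'\in\mathcal C$ for every $\alpha\in k$.
   Context: For a field $k$, let $F_k$ be the free monoid of finite words with letters in $k$ (concatenation as product). For $\alpha\in k$ put $M_\alpha=\begin{pmatrix}0&-1\\1&\alpha\end{pmatrix}$ and $\pi(\alpha_1\cdots\alpha_l)=M_{\alpha_1}\cdots M_{\alpha_l}\in\mathrm{SL}_2(k)$ (identity for the empty word). Let $\mathcal A$ be the set of words $w$ with $\pi(w)$ having lower-right entry $0$ (equivalently $\pi(w)=\begin{pmatrix}a&-b\\ b^{ -1}&0\end{pmatrix}$, $a\in k$, $b\in k^*$), and $\mathcal C=F_k\setminus\mathcal A$. -}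

module Defs where

open import Level using (Level; _⊔_; suc)
open import Data.List using (List; []; _∷_; _++_)
open import Data.Product using (_×_; ∃-syntax)
open import Relation.Nullary using (¬_)
open import Algebra.Bundles using (CommutativeRing)

record Field (c ℓ : Level) : Set (suc (c ⊔ ℓ)) where
  field
    commutativeRing : CommutativeRing c ℓ
  open CommutativeRing commutativeRing public
  field
    0≉1     : ¬ (0# ≈ 1#)
    inverse : ∀ x → ¬ (x ≈ 0#) → ∃[ y ] (x * y ≈ 1#)

module FreeMonoidSL2 {c ℓ : Level} (k : Field c ℓ) where
  open Field k

  record Mat2 : Set c where
    constructor mat
    field
      a₁₁ a₁₂ a₂₁ a₂₂ : Carrier
  open Mat2 public

  _⊗_ : Mat2 → Mat2 → Mat2
  mat a b c d ⊗ mat a' b' c' d' =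
    mat (a * a' + b * c') (a * b' + b * d') (c * a' + d * c') (c * b' + d * d')

  I₂ : Mat2
  I₂ = mat 1# 0# 0# 1#

  M : Carrier → Mat2
  M α = mat 0# (- 1#) 1# α

  -- F_k: the free monoid of finite words with letters in k (product = _++_)
  Word : Set c
  Word = List Carrier

  π : Word → Mat2
  π []      = I₂
  π (α ∷ w) = M α ⊗ π w

  𝒜 : Word → Set ℓ
  𝒜 w = a₂₂ (π w) ≈ 0#

  𝒞 : Word → Set ℓ
  𝒞 w = ¬ 𝒜 w

{-# OPTIONS --safe #-}
module Submission where

-- Write π u = (a b / c d).  Since π is a monoid homomorphism, the lower-right
-- entry of π (u ++ v) is c(u) b(v) + d(u) d(v), which is c(u) b(v) as soon as
-- u or v lies in 𝒜.  Every π u has determinant 1, so d(u) = 0 forces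
-- b(u) ≠ 0 and c(u) ≠ 0.  A letter α inserted between w and w' is absorbed
-- into either side, using b(α w') = - d(w') and c(w α) = d(w); as k has no
-- zero divisors, each claim becomes the (non)vanishing of one product.

open import Defs
open import Level using (Level)
open import Algebra.Bundles using (CommutativeRing)
open import Data.List using ([]; _∷_; _++_; [_])
open import Data.List.Properties using (++-assoc)
open import Data.Product using (_×_; _,_)
open import Data.Sum using (_⊎_; inj₁; inj₂)
open import Function using (_∘_)
import Relation.Binary.PropositionalEquality as ≡

module CommutativeRingProperties {c ℓ : Level} (R : CommutativeRing c ℓ) where
  open CommutativeRing R
  open import Algebra.Properties.Ring ring using (-0#≈0#; -‿involutive; -‿anti-homo-+)
  open import Algebra.Solver.Ring.NaturalCoefficients.Default commutativeSemiring
    using (solve; _:+_; _:=_)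
  open import Relation.Binary.Reasoning.Setoid setoid

  x≈0∨y≈0⇒xy≈0 : ∀ {x y} → x ≈ 0# ⊎ y ≈ 0# → x * y ≈ 0#
  x≈0∨y≈0⇒xy≈0 {y = y} (inj₁ x≈0) = trans (*-congʳ x≈0) (zeroˡ y)
  x≈0∨y≈0⇒xy≈0 {x = x} (inj₂ y≈0) = trans (*-congˡ y≈0) (zeroʳ x)

  x≉0⇒-x≉0 : ∀ {x} → x ≉ 0# → - x ≉ 0#
  x≉0⇒-x≉0 {x} x≉0 -x≈0 = x≉0 (trans (sym (-‿involutive x)) (trans (-‿cong -x≈0) -0#≈0#))

  -[x+z]+[y+z]≈y-x : ∀ x y z → - (x + z) + (y + z) ≈ y - x
  -[x+z]+[y+z]≈y-x x y z = begin
    - (x + z) + (y + z)    ≈⟨ +-congʳ (-‿anti-homo-+ x z) ⟩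
    (- z - x) + (y + z)    ≈⟨ regroup (- z) (- x) y z ⟩
    (y - x) + (z - z)      ≈⟨ +-congˡ (-‿inverseʳ z) ⟩
    (y - x) + 0#           ≈⟨ +-identityʳ (y - x) ⟩
    y - x                  ∎
    where
    regroup : ∀ p q r s → (p + q) + (r + s) ≈ (r + q) + (s + p)
    regroup = solve 4 (λ p q r s → (p :+ q) :+ (r :+ s) := (r :+ q) :+ (s :+ p)) refl

module FieldProperties {c ℓ : Level} (k : Field c ℓ) where
  open Field k
  open CommutativeRingProperties commutativeRing using (x≈0∨y≈0⇒xy≈0)
  open import Relation.Binary.Reasoning.Setoid setoid

  x≉0∧y≉0⇒xy≉0 : ∀ {x y} → x ≉ 0# → y ≉ 0# → x * y ≉ 0#
  x≉0∧y≉0⇒xy≉0 {x} {y} x≉0 y≉0 xy≈0 with inverse x x≉0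
  ... | x⁻¹ , x*x⁻¹≈1 = y≉0 (begin
    y                ≈⟨ *-identityˡ y ⟨
    1# * y           ≈⟨ *-congʳ x*x⁻¹≈1 ⟨
    (x * x⁻¹) * y    ≈⟨ *-congʳ (*-comm x x⁻¹) ⟩
    (x⁻¹ * x) * y    ≈⟨ *-assoc x⁻¹ x y ⟩
    x⁻¹ * (x * y)    ≈⟨ x≈0∨y≈0⇒xy≈0 (inj₂ xy≈0) ⟩
    0#               ∎)

module Mat2Properties {c ℓ : Level} (k : Field c ℓ) where
  open Field k
  open FreeMonoidSL2 k
  open CommutativeRingProperties commutativeRing using (-[x+z]+[y+z]≈y-x)
  open import Algebra.Properties.Ring ring using (-1*x≈-x; -‿distribˡ-*; -‿involutive)
  open import Algebra.Solver.Ring.NaturalCoefficients.Default commutativeSemiring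
    using (solve; _:*_; _:+_; _:=_)
  open import Relation.Binary.Reasoning.Setoid setoid

  infix 4 _≋_
  record _≋_ (P Q : Mat2) : Set ℓ where
    constructor ≋-entries
    field
      a₁₁-≈ : a₁₁ P ≈ a₁₁ Q
      a₁₂-≈ : a₁₂ P ≈ a₁₂ Q
      a₂₁-≈ : a₂₁ P ≈ a₂₁ Q
      a₂₂-≈ : a₂₂ P ≈ a₂₂ Q
  open _≋_ public

  ≋-sym : ∀ {P Q} → P ≋ Q → Q ≋ P
  ≋-sym (≋-entries p₁₁ p₁₂ p₂₁ p₂₂) = ≋-entries (sym p₁₁) (sym p₁₂) (sym p₂₁) (sym p₂₂)

  ≋-trans : ∀ {P Q R} → P ≋ Q → Q ≋ R → P ≋ R
  ≋-trans (≋-entries p₁₁ p₁₂ p₂₁ p₂₂) (≋-entries q₁₁ q₁₂ q₂₁ q₂₂) =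
    ≋-entries (trans p₁₁ q₁₁) (trans p₁₂ q₁₂) (trans p₂₁ q₂₁) (trans p₂₂ q₂₂)

  ⊗-congˡ : ∀ P {Q R} → Q ≋ R → P ⊗ Q ≋ P ⊗ R
  ⊗-congˡ P (≋-entries q₁₁ q₁₂ q₂₁ q₂₂) =
    ≋-entries (+-cong (*-congˡ q₁₁) (*-congˡ q₂₁)) (+-cong (*-congˡ q₁₂) (*-congˡ q₂₂))
              (+-cong (*-congˡ q₁₁) (*-congˡ q₂₁)) (+-cong (*-congˡ q₁₂) (*-congˡ q₂₂))

  ⊗-assoc : ∀ P Q R → (P ⊗ Q) ⊗ R ≋ P ⊗ (Q ⊗ R)
  ⊗-assoc (mat a b c d) (mat a' b' c' d') (mat a'' b'' c'' d'') =
    ≋-entries (entry a a' b c' a'' b' d' c'') (entry a a' b c' b'' b' d' d'')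
              (entry c a' d c' a'' b' d' c'') (entry c a' d c' b'' b' d' d'')
    where
    entry : ∀ p q r s t u v w →
            (p * q + r * s) * t + (p * u + r * v) * w ≈ p * (q * t + u * w) + r * (s * t + v * w)
    entry = solve 8 (λ p q r s t u v w →
      (p :* q :+ r :* s) :* t :+ (p :* u :+ r :* v) :* w := p :* (q :* t :+ u :* w) :+ r :* (s :* t :+ v :* w)) refl

  ⊗-identityˡ : ∀ P → I₂ ⊗ P ≋ P
  ⊗-identityˡ (mat a b c d) = ≋-entries (1x+0y≈x a c) (1x+0y≈x b d) (0x+1y≈y a c) (0x+1y≈y b d)
    where
    1x+0y≈x : ∀ x y → 1# * x + 0# * y ≈ x
    1x+0y≈x x y = trans (+-cong (*-identityˡ x) (zeroˡ y)) (+-identityʳ x)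
    0x+1y≈y : ∀ x y → 0# * x + 1# * y ≈ y
    0x+1y≈y x y = trans (+-cong (zeroˡ x) (*-identityˡ y)) (+-identityˡ y)

  ⊗-identityʳ : ∀ P → P ⊗ I₂ ≋ P
  ⊗-identityʳ (mat a b c d) = ≋-entries (x1+y0≈x a b) (x0+y1≈y a b) (x1+y0≈x c d) (x0+y1≈y c d)
    where
    x1+y0≈x : ∀ x y → x * 1# + y * 0# ≈ x
    x1+y0≈x x y = trans (+-cong (*-identityʳ x) (zeroʳ y)) (+-identityʳ x)
    x0+y1≈y : ∀ x y → x * 0# + y * 1# ≈ y
    x0+y1≈y x y = trans (+-cong (zeroʳ x) (*-identityʳ y)) (+-identityˡ y)

  M-⊗ : ∀ α P → M α ⊗ P ≋ mat (- a₂₁ P) (- a₂₂ P) (a₁₁ P + α * a₂₁ P) (a₁₂ P + α * a₂₂ P)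
  M-⊗ α (mat a b c d) =
    ≋-entries (0x-y≈-y a c) (0x-y≈-y b d) (+-congʳ (*-identityˡ a)) (+-congʳ (*-identityˡ b))
    where
    0x-y≈-y : ∀ x y → 0# * x + - 1# * y ≈ - y
    0x-y≈-y x y = trans (+-cong (zeroˡ x) (-1*x≈-x y)) (+-identityˡ (- y))

  a₂₁-⊗-M : ∀ P α → a₂₁ (P ⊗ M α) ≈ a₂₂ P
  a₂₁-⊗-M (mat a b c d) α = trans (+-cong (zeroʳ c) (*-identityʳ d)) (+-identityˡ d)

  det : Mat2 → Carrier
  det P = a₁₁ P * a₂₂ P - a₁₂ P * a₂₁ P

  det-cong : ∀ {P Q} → P ≋ Q → det P ≈ det Q
  det-cong (≋-entries p₁₁ p₁₂ p₂₁ p₂₂) = +-cong (*-cong p₁₁ p₂₂) (-‿cong (*-cong p₁₂ p₂₁))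

  det-M-⊗ : ∀ α P → det (M α ⊗ P) ≈ det P
  det-M-⊗ α P@(mat a b c d) = begin
    det (M α ⊗ P)                                  ≈⟨ det-cong (M-⊗ α P) ⟩
    - c * (b + α * d) - - d * (a + α * c)          ≈⟨ +-cong (sym (-‿distribˡ-* c _)) (-[-x*y]≈x*y d _) ⟩
    - (c * (b + α * d)) + d * (a + α * c)          ≈⟨ +-cong (-‿cong expandˡ) expandʳ ⟩
    - (b * c + α * c * d) + (a * d + α * c * d)    ≈⟨ -[x+z]+[y+z]≈y-x (b * c) (a * d) (α * c * d) ⟩
    a * d - b * c                                  ∎
    where
    -[-x*y]≈x*y : ∀ x y → - (- x * y) ≈ x * y
    -[-x*y]≈x*y x y = trans (-‿cong (sym (-‿distribˡ-* x y))) (-‿involutive (x * y))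
    expandˡ : c * (b + α * d) ≈ b * c + α * c * d
    expandˡ = solve 4 (λ α b c d → c :* (b :+ α :* d) := b :* c :+ α :* c :* d) refl α b c d
    expandʳ : d * (a + α * c) ≈ a * d + α * c * d
    expandʳ = solve 4 (λ α a c d → d :* (a :+ α :* c) := a :* d :+ α :* c :* d) refl α a c d

module WordProperties {c ℓ : Level} (k : Field c ℓ) where
  open Field k
  open FreeMonoidSL2 k
  open CommutativeRingProperties commutativeRing using (x≈0∨y≈0⇒xy≈0)
  open Mat2Properties k
  open import Algebra.Properties.Ring ring using (-0#≈0#)
  open import Relation.Binary.Reasoning.Setoid setoid

  π-++ : ∀ u v → π (u ++ v) ≋ π u ⊗ π v
  π-++ []      v = ≋-sym (⊗-identityˡ (π v))
  π-++ (α ∷ u) v = ≋-trans (⊗-congˡ (M α) (π-++ u v)) (≋-sym (⊗-assoc (M α) (π u) (π v)))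

  det-π : ∀ w → det (π w) ≈ 1#
  det-π []      = trans (+-cong (*-identityˡ 1#) (trans (-‿cong (zeroˡ 0#)) -0#≈0#)) (+-identityʳ 1#)
  det-π (α ∷ w) = trans (det-M-⊗ α (π w)) (det-π w)

  𝒜⇒a₁₂*a₂₁≉0 : ∀ w → 𝒜 w → a₁₂ (π w) * a₂₁ (π w) ≉ 0#
  𝒜⇒a₁₂*a₂₁≉0 w 𝒜w bc≈0 = 0≉1 (begin
    0#           ≈⟨ +-identityʳ 0# ⟨
    0# + 0#      ≈⟨ +-cong (x≈0∨y≈0⇒xy≈0 (inj₂ 𝒜w)) (trans (-‿cong bc≈0) -0#≈0#) ⟨
    det (π w)    ≈⟨ det-π w ⟩
    1#           ∎)

  𝒜⇒a₁₂≉0 : ∀ w → 𝒜 w → a₁₂ (π w) ≉ 0#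
  𝒜⇒a₁₂≉0 w 𝒜w b≈0 = 𝒜⇒a₁₂*a₂₁≉0 w 𝒜w (x≈0∨y≈0⇒xy≈0 (inj₁ b≈0))

  𝒜⇒a₂₁≉0 : ∀ w → 𝒜 w → a₂₁ (π w) ≉ 0#
  𝒜⇒a₂₁≉0 w 𝒜w c≈0 = 𝒜⇒a₁₂*a₂₁≉0 w 𝒜w (x≈0∨y≈0⇒xy≈0 (inj₂ c≈0))

  a₁₂-π-∷ : ∀ α v → a₁₂ (π (α ∷ v)) ≈ - a₂₂ (π v)
  a₁₂-π-∷ α v = a₁₂-≈ (M-⊗ α (π v))

  a₂₁-π-∷ʳ : ∀ w α → a₂₁ (π (w ++ [ α ])) ≈ a₂₂ (π w)
  a₂₁-π-∷ʳ w α = trans (a₂₁-≈ π[w++α]≋π[w]⊗Mα) (a₂₁-⊗-M (π w) α)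
    where
    π[w++α]≋π[w]⊗Mα : π (w ++ [ α ]) ≋ π w ⊗ M α
    π[w++α]≋π[w]⊗Mα = ≋-trans (π-++ w [ α ]) (⊗-congˡ (π w) (⊗-identityʳ (M α)))

  a₂₂-π-++-𝒜 : ∀ u v → 𝒜 u ⊎ 𝒜 v → a₂₂ (π (u ++ v)) ≈ a₂₁ (π u) * a₁₂ (π v)
  a₂₂-π-++-𝒜 u v 𝒜u⊎𝒜v = begin
    a₂₂ (π (u ++ v))                                    ≈⟨ a₂₂-≈ (π-++ u v) ⟩
    a₂₁ (π u) * a₁₂ (π v) + a₂₂ (π u) * a₂₂ (π v)       ≈⟨ +-congˡ (x≈0∨y≈0⇒xy≈0 𝒜u⊎𝒜v) ⟩
    a₂₁ (π u) * a₁₂ (π v) + 0#                          ≈⟨ +-identityʳ _ ⟩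
    a₂₁ (π u) * a₁₂ (π v)                               ∎

  a₂₂-π-++-∷-𝒜ˡ : ∀ w α v → 𝒜 w → a₂₂ (π (w ++ α ∷ v)) ≈ a₂₁ (π w) * - a₂₂ (π v)
  a₂₂-π-++-∷-𝒜ˡ w α v 𝒜w = trans (a₂₂-π-++-𝒜 w (α ∷ v) (inj₁ 𝒜w)) (*-congˡ (a₁₂-π-∷ α v))

  a₂₂-π-++-∷-𝒜ʳ : ∀ w α v → 𝒜 v → a₂₂ (π (w ++ α ∷ v)) ≈ a₂₂ (π w) * a₁₂ (π v)
  a₂₂-π-++-∷-𝒜ʳ w α v 𝒜v = begin
    a₂₂ (π (w ++ α ∷ v))                ≡⟨ ≡.cong (a₂₂ ∘ π) (++-assoc w [ α ] v) ⟨
    a₂₂ (π ((w ++ [ α ]) ++ v))         ≈⟨ a₂₂-π-++-𝒜 (w ++ [ α ]) v (inj₂ 𝒜v) ⟩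
    a₂₁ (π (w ++ [ α ])) * a₁₂ (π v)    ≈⟨ *-congʳ (a₂₁-π-∷ʳ w α) ⟩
    a₂₂ (π w) * a₁₂ (π v)               ∎

lemma3p2 : {c ℓ : Level} (k : Field c ℓ) →
    let open Field k
        open FreeMonoidSL2 k
    in (w w' : Word) →
       ((𝒜 w → 𝒜 w' → 𝒞 (w ++ w') × (∀ (α : Carrier) → 𝒜 (w ++ (α ∷ w'))))
       × ((𝒜 w → 𝒞 w' → ∀ (α : Carrier) → 𝒞 (w ++ (α ∷ w')))
         × (𝒞 w → 𝒜 w' → ∀ (α : Carrier) → 𝒞 (w ++ (α ∷ w')))))
lemma3p2 k w w' =
  (λ 𝒜w 𝒜w' →
     (x≉0∧y≉0⇒xy≉0 (𝒜⇒a₂₁≉0 w 𝒜w) (𝒜⇒a₁₂≉0 w' 𝒜w') ∘ trans (sym (a₂₂-π-++-𝒜 w w' (inj₁ 𝒜w)))) ,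
     (λ α → trans (a₂₂-π-++-∷-𝒜ʳ w α w' 𝒜w') (x≈0∨y≈0⇒xy≈0 (inj₁ 𝒜w)))) ,
  (λ 𝒜w 𝒞w' α →
     x≉0∧y≉0⇒xy≉0 (𝒜⇒a₂₁≉0 w 𝒜w) (x≉0⇒-x≉0 𝒞w') ∘ trans (sym (a₂₂-π-++-∷-𝒜ˡ w α w' 𝒜w))) ,
  (λ 𝒞w 𝒜w' α →
     x≉0∧y≉0⇒xy≉0 𝒞w (𝒜⇒a₁₂≉0 w' 𝒜w') ∘ trans (sym (a₂₂-π-++-∷-𝒜ʳ w α w' 𝒜w')))
  where
  open Field k
  open CommutativeRingProperties commutativeRing using (x≈0∨y≈0⇒xy≈0; x≉0⇒-x≉0)
  open FieldProperties k
  open WordProperties k
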